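{- Let $d\ge3$ and let $G$ be a finite, simple, connected graph with at least two vertices. If $\mathrm{QEC}(G)<\mathrm{QEC}(P_d)$, then $\mathrm{diam}(G)\le d-2$ and $\mathrm{diam}(\Gamma(G))\le d-3$.
   Context: $P_d$ is the path on $d$ vertices. For a finite connected graph $G=(V,E)$ with $|V|\ge2$, let $D=[d_G(x,y)]_{x,y\in V}$ be its distance matrix ($d_G$ the graph distance). The quadratic embedding constant is $\mathrm{QEC}(G)=\max\{\langle f,Df\rangle : f\in\mathbb{R}^V,\ \langle f,f\rangle=1,\ \langle \mathbf{1},f\rangle=0\}$, where $\mathbf{1}$ is the all-ones vector. A maximal clique is a vertex subset inducing a complete graph, maximal under inclusion. The clique graph $\Gamma(G)$ has as vertices the maximal cliques of $G$, with two maximal cliques $H_1,H_2$ adjacent iff $H_1\neq H_2$ and $H_1\cap H_2\neq\emptyset$. $\mathrm{diam}$ denotes diameter. -}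

module Defs where

open import Data.Nat as ℕ using (ℕ; zero; suc)
open import Data.Integer using (+_)
open import Data.Fin using (Fin; toℕ)
import Data.Fin as Fin
open import Data.Fin.Subset using (Subset; _∈_; _⊆_; _∩_; Nonempty)
open import Data.Bool using (Bool; true; false; _∨_)
open import Data.Bool.Properties using (∨-comm)
open import Data.Product using (Σ; ∃; _×_; _,_)
open import Data.Rational using (ℚ; 0ℚ; _+_; _*_; _≤_; _<_; _/_)
open import Relation.Binary.PropositionalEquality using (_≡_; _≢_; refl)

record SimpleGraph (n : ℕ) : Set where
  field
    adj   : Fin n → Fin n → Bool
    sym   : ∀ x y → adj x y ≡ adj y x
    irrefl : ∀ x → adj x x ≡ false
open SimpleGraph public

Adj : ∀ {n} → SimpleGraph n → Fin n → Fin n → Set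
Adj G x y = adj G x y ≡ true

data Walk {n : ℕ} (G : SimpleGraph n) : Fin n → Fin n → ℕ → Set where
  nil  : ∀ {x} → Walk G x x 0
  cons : ∀ {x y z k} → Adj G x y → Walk G y z k → Walk G x z (suc k)

Connected : ∀ {n} → SimpleGraph n → Set
Connected G = ∀ x y → ∃ λ k → Walk G x y k

IsDist : ∀ {n} → SimpleGraph n → Fin n → Fin n → ℕ → Set
IsDist G x y k = Walk G x y k × (∀ j → Walk G x y j → k ℕ.≤ j)

IsDistMatrix : ∀ {n} → SimpleGraph n → (Fin n → Fin n → ℕ) → Set
IsDistMatrix G D = ∀ x y → IsDist G x y (D x y)

pathAdj : ∀ {d} → Fin d → Fin d → Bool
pathAdj i j = (toℕ i ℕ.≡ᵇ suc (toℕ j)) ∨ (toℕ j ℕ.≡ᵇ suc (toℕ i))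

private
  pathSym : ∀ {d} (i j : Fin d) → pathAdj i j ≡ pathAdj j i
  pathSym i j = ∨-comm (toℕ i ℕ.≡ᵇ suc (toℕ j)) _

  n≡ᵇ1+n : ∀ k → (k ℕ.≡ᵇ suc k) ≡ false
  n≡ᵇ1+n zero = refl
  n≡ᵇ1+n (suc k) = n≡ᵇ1+n k

  pathIrr : ∀ {d} (i : Fin d) → pathAdj i i ≡ false
  pathIrr i rewrite n≡ᵇ1+n (toℕ i) = refl

Path : (d : ℕ) → SimpleGraph d
Path d = record { adj = pathAdj ; sym = pathSym ; irrefl = pathIrr }

-- Quadratic embedding constant (compared via rational test vectors).

Σ[_] : (n : ℕ) → (Fin n → ℚ) → ℚ
Σ[ zero ] f = 0ℚ
Σ[ suc n ] f = f Fin.zero + Σ[ n ] (λ i → f (Fin.suc i))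

ℕ→ℚ : ℕ → ℚ
ℕ→ℚ k = + k / 1

quadForm : ∀ {n} → (Fin n → Fin n → ℕ) → (Fin n → ℚ) → ℚ
quadForm {n} D f = Σ[ n ] (λ x → Σ[ n ] (λ y → f x * (ℕ→ℚ (D x y) * f y)))

normSq : ∀ {n} → (Fin n → ℚ) → ℚ
normSq {n} f = Σ[ n ] (λ x → f x * f x)

SumZero : ∀ {n} → (Fin n → ℚ) → Set
SumZero {n} f = Σ[ n ] f ≡ 0ℚ

QEC≤ : ∀ {n} → (Fin n → Fin n → ℕ) → ℚ → Set
QEC≤ D q = ∀ f → SumZero f → quadForm D f ≤ q * normSq f

QEC> : ∀ {n} → (Fin n → Fin n → ℕ) → ℚ → Set
QEC> D q = ∃ λ f → SumZero f × (q * normSq f < quadForm D f)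

QEC< : ∀ {n m} → (Fin n → Fin n → ℕ) → (Fin m → Fin m → ℕ) → Set
QEC< D₁ D₂ = ∃ λ q → QEC≤ D₁ q × QEC> D₂ q

IsClique : ∀ {n} → SimpleGraph n → Subset n → Set
IsClique G C = ∀ x y → x ∈ C → y ∈ C → x ≢ y → Adj G x y

IsMaximalClique : ∀ {n} → SimpleGraph n → Subset n → Set
IsMaximalClique G C = IsClique G C × (∀ C' → IsClique G C' → C ⊆ C' → C' ⊆ C)

data CliqueWalk {n : ℕ} (G : SimpleGraph n) : Subset n → Subset n → ℕ → Set where
  nil  : ∀ {C} → CliqueWalk G C C 0
  cons : ∀ {C C' E k} → IsMaximalClique G C' → C ≢ C' → Nonempty (C ∩ C') →
         CliqueWalk G C' E k → CliqueWalk G C E (suc k)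

DiamLe : ∀ {n} → (Fin n → Fin n → ℕ) → ℕ → Set
DiamLe D m = ∀ x y → D x y ℕ.≤ m

CliqueDiamLe : ∀ {n} → SimpleGraph n → ℕ → Set
CliqueDiamLe G m = ∀ C C' → IsMaximalClique G C → IsMaximalClique G C' →
  ∃ λ k → k ℕ.≤ m × CliqueWalk G C C' k

{-# OPTIONS --safe #-}
-- A geodesic of length at least d - 1 in G is an isometric copy of P_d, and
-- QEC can only decrease under isometric embeddings; this bounds diam G.
--
-- For the clique graph, the distance matrix of P_d satisfies
-- 2 <f, D f> + <f, f> <= 0 whenever sum f = 0, so QEC(G) < QEC(P_d) <= -1/2.
-- Testing (1, -1, 1, -1) on four distinct vertices then shows that G has no
-- quadrilateral whose perimeter exceeds its diagonal sum by at most 1.  From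
-- this, every vertex has a unique nearest point in each maximal clique, and
-- two distinct maximal cliques at distance m contain vertices at distance
-- m + 2, while a geodesic between them gives a walk of length m + 1 in the
-- clique graph.  Hence diam Γ(G) <= diam G - 1 <= d - 3.
module Submission where

open import Defs hiding (sym)
open import Algebra.Bundles using (CommutativeRing)
open import Data.Bool as Bool using (true; if_then_else_)
open import Data.Empty using (⊥; ⊥-elim)
open import Data.Fin as Fin using (Fin; toℕ; _≟_)
open import Data.Fin.Patterns using (0F; 1F; 2F; 3F)
import Data.Fin.Properties as FinP
open import Data.Fin.Subset using (Subset; _∈_; _∉_; _⊆_; _∪_; ⁅_⁆; ∣_∣)
import Data.Fin.Subset.Properties as SubsetP
import Data.Integer as ℤ
import Data.Integer.Properties as ℤP
open import Data.Nat as ℕ using (ℕ; zero; suc; _≤_; _∸_; z≤n; s≤s)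
import Data.Nat.Properties as ℕP
import Data.Nat.Tactic.RingSolver as ℕ-Solver
open import Data.Product using (_×_; _,_; ∃; proj₁; proj₂)
open import Data.Rational as ℚ using (ℚ; 0ℚ; 1ℚ; _+_; _*_; -_)
import Data.Rational.Properties as ℚP
open import Algebra.Properties.Semiring.Sum (CommutativeRing.semiring ℚP.+-*-commutativeRing)
  using (sum; sum-replicate-zero; ∑-distrib-+; ∑-comm; *-distribˡ-sum; *-distribʳ-sum)
open import Data.Rational.Solver using (module +-*-Solver)
open import Data.Rational.Unnormalised as ℚᵘ using (mkℚᵘ; *≡*)
import Data.Rational.Unnormalised.Properties as ℚᵘP
open import Data.Sum using (_⊎_; inj₁; inj₂)
open import Data.Vec using ([]; _∷_; lookup)
import Data.Vec.Properties as VecP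
open import Data.Vec.Relation.Unary.All using ([]; _∷_)
open import Data.Vec.Relation.Unary.AllPairs using ([]; _∷_)
open import Data.Vec.Relation.Unary.Unique.Propositional using (Unique)
open import Data.Vec.Relation.Unary.Unique.Propositional.Properties using (lookup-injective)
open import Function using (_∘_; id)
open import Function.Definitions using (Injective)
open import Relation.Binary.Definitions using (tri<; tri≈; tri>)
open import Relation.Binary.PropositionalEquality
open import Relation.Nullary using (¬_; Dec; yes; no; does; ¬?)
open import Relation.Nullary.Decidable using (_×-dec_; _→-dec_; decidable-stable; map′)
open import Relation.Unary using (Decidable)

open +-*-Solver

ℕ→ℚ-+ : ∀ m n → ℕ→ℚ (m ℕ.+ n) ≡ ℕ→ℚ m + ℕ→ℚ n
ℕ→ℚ-+ m n = ℚP.toℚᵘ-injective (begin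
  ℚ.toℚᵘ (ℕ→ℚ (m ℕ.+ n))               ≈⟨ ℚP.toℚᵘ-fromℚᵘ (mkℚᵘ (ℤ.+ (m ℕ.+ n)) 0) ⟩
  mkℚᵘ (ℤ.+ (m ℕ.+ n)) 0               ≈⟨ *≡* integral ⟩
  mkℚᵘ (ℤ.+ m) 0 ℚᵘ.+ mkℚᵘ (ℤ.+ n) 0   ≈⟨ ℚᵘP.+-cong (ℚᵘP.≃-sym (ℚP.toℚᵘ-fromℚᵘ (mkℚᵘ (ℤ.+ m) 0)))
                                                    (ℚᵘP.≃-sym (ℚP.toℚᵘ-fromℚᵘ (mkℚᵘ (ℤ.+ n) 0))) ⟩
  ℚ.toℚᵘ (ℕ→ℚ m) ℚᵘ.+ ℚ.toℚᵘ (ℕ→ℚ n)   ≈⟨ ℚᵘP.≃-sym (ℚP.toℚᵘ-homo-+ (ℕ→ℚ m) (ℕ→ℚ n)) ⟩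
  ℚ.toℚᵘ (ℕ→ℚ m + ℕ→ℚ n)               ∎)
  where
  open ℚᵘP.≃-Reasoning
  integral : ℤ.+ (m ℕ.+ n) ℤ.* ℤ.+ 1 ≡ (ℤ.+ m ℤ.* ℤ.+ 1 ℤ.+ ℤ.+ n ℤ.* ℤ.+ 1) ℤ.* ℤ.+ 1
  integral = cong (ℤ._* ℤ.+ 1) (trans (ℤP.pos-+ m n) (sym (cong₂ ℤ._+_ (ℤP.*-identityʳ (ℤ.+ m)) (ℤP.*-identityʳ (ℤ.+ n)))))

ℕ→ℚ-suc : ∀ n → ℕ→ℚ (suc n) ≡ ℕ→ℚ n + 1ℚ
ℕ→ℚ-suc n = trans (cong ℕ→ℚ (ℕP.+-comm 1 n)) (ℕ→ℚ-+ n 1)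

ℕ→ℚ-mono-≤ : ∀ {m n} → m ≤ n → ℕ→ℚ m ℚ.≤ ℕ→ℚ n
ℕ→ℚ-mono-≤ {m} {n} m≤n = begin
  ℕ→ℚ m                      ≡⟨ ℚP.+-identityʳ (ℕ→ℚ m) ⟨
  ℕ→ℚ m + 0ℚ                 ≤⟨ ℚP.+-monoʳ-≤ (ℕ→ℚ m) (ℚP.nonNegative⁻¹ _ {{ℚP.normalize-nonNeg (n ∸ m) 1}}) ⟩
  ℕ→ℚ m + ℕ→ℚ (n ∸ m)        ≡⟨ ℕ→ℚ-+ m (n ∸ m) ⟨
  ℕ→ℚ (m ℕ.+ (n ∸ m))        ≡⟨ cong ℕ→ℚ (ℕP.m+[n∸m]≡n m≤n) ⟩
  ℕ→ℚ n                      ∎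
  where open ℚP.≤-Reasoning

Σ≡sum : ∀ {n} (f : Fin n → ℚ) → Σ[ n ] f ≡ sum f
Σ≡sum {zero}  f = refl
Σ≡sum {suc n} f = cong (f 0F +_) (Σ≡sum (f ∘ Fin.suc))

Σ-cong : ∀ {n} {f g : Fin n → ℚ} → (∀ i → f i ≡ g i) → Σ[ n ] f ≡ Σ[ n ] g
Σ-cong {zero}  eq = refl
Σ-cong {suc n} eq = cong₂ _+_ (eq 0F) (Σ-cong (eq ∘ Fin.suc))

Σ-zero : ∀ n → Σ[ n ] (λ _ → 0ℚ) ≡ 0ℚ
Σ-zero n = trans (Σ≡sum {n} (λ _ → 0ℚ)) (sum-replicate-zero n)

Σ-+ : ∀ {n} (f g : Fin n → ℚ) → Σ[ n ] (λ i → f i + g i) ≡ Σ[ n ] f + Σ[ n ] g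
Σ-+ f g = trans (Σ≡sum (λ i → f i + g i)) (trans (∑-distrib-+ f g) (sym (cong₂ _+_ (Σ≡sum f) (Σ≡sum g))))

Σ-*ˡ : ∀ {n} c (f : Fin n → ℚ) → c * Σ[ n ] f ≡ Σ[ n ] (λ i → c * f i)
Σ-*ˡ c f = trans (cong (c *_) (Σ≡sum f)) (trans (*-distribˡ-sum c f) (sym (Σ≡sum (λ i → c * f i))))

Σ-*ʳ : ∀ {n} c (f : Fin n → ℚ) → Σ[ n ] f * c ≡ Σ[ n ] (λ i → f i * c)
Σ-*ʳ c f = trans (cong (_* c) (Σ≡sum f)) (trans (*-distribʳ-sum c f) (sym (Σ≡sum (λ i → f i * c))))

Σ-comm : ∀ {m n} (f : Fin m → Fin n → ℚ) →
         Σ[ m ] (λ i → Σ[ n ] (f i)) ≡ Σ[ n ] (λ j → Σ[ m ] (λ i → f i j))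
Σ-comm {m} {n} f = begin
  Σ[ m ] (λ i → Σ[ n ] (f i))              ≡⟨ trans (Σ-cong (λ i → Σ≡sum (f i))) (Σ≡sum (λ i → sum (f i))) ⟩
  sum (λ i → sum (f i))                    ≡⟨ ∑-comm f ⟩
  sum (λ j → sum (λ i → f i j))            ≡⟨ trans (Σ-cong (λ j → Σ≡sum (λ i → f i j))) (Σ≡sum (λ j → sum (λ i → f i j))) ⟨
  Σ[ n ] (λ j → Σ[ m ] (λ i → f i j))      ∎
  where open ≡-Reasoning

Σ-nonNeg : ∀ {n} (f : Fin n → ℚ) → (∀ i → 0ℚ ℚ.≤ f i) → 0ℚ ℚ.≤ Σ[ n ] f
Σ-nonNeg {zero}  f f≥0 = ℚP.≤-refl
Σ-nonNeg {suc n} f f≥0 = ℚP.+-mono-≤ (f≥0 0F) (Σ-nonNeg (f ∘ Fin.suc) (f≥0 ∘ Fin.suc))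

δ : ∀ {n} → Fin n → Fin n → ℚ
δ a b = if does (a ≟ b) then 1ℚ else 0ℚ

δ-comm : ∀ {n} (a b : Fin n) → δ a b ≡ δ b a
δ-comm 0F          0F          = refl
δ-comm 0F          (Fin.suc b) = refl
δ-comm (Fin.suc a) 0F          = refl
δ-comm (Fin.suc a) (Fin.suc b) = δ-comm a b

Σ-δ : ∀ {n} (a : Fin n) (h : Fin n → ℚ) → Σ[ n ] (λ x → δ a x * h x) ≡ h a
Σ-δ {suc n} 0F h = begin
  1ℚ * h 0F + Σ[ n ] (λ x → 0ℚ * h (Fin.suc x))   ≡⟨ cong (1ℚ * h 0F +_) (trans (Σ-cong (ℚP.*-zeroˡ ∘ h ∘ Fin.suc)) (Σ-zero n)) ⟩
  1ℚ * h 0F + 0ℚ                                  ≡⟨ solve 1 (λ x → con 1ℚ :* x :+ con 0ℚ := x) refl (h 0F) ⟩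
  h 0F                                            ∎
  where open ≡-Reasoning
Σ-δ {suc n} (Fin.suc a) h = begin
  0ℚ * h 0F + Σ[ n ] (λ x → δ a x * h (Fin.suc x))  ≡⟨ cong (0ℚ * h 0F +_) (Σ-δ a (h ∘ Fin.suc)) ⟩
  0ℚ * h 0F + h (Fin.suc a)                        ≡⟨ solve 2 (λ x y → con 0ℚ :* x :+ y := y) refl (h 0F) (h (Fin.suc a)) ⟩
  h (Fin.suc a)                                    ∎
  where open ≡-Reasoning

δ-injective : ∀ {k n} (p : Fin k → Fin n) → Injective _≡_ _≡_ p → ∀ i j → δ (p i) (p j) ≡ δ i j
δ-injective p p-inj i j with i ≟ j | p i ≟ p j
... | yes _   | yes _     = refl
... | no  _   | no  _     = refl
... | yes i≡j | no  pi≢pj = ⊥-elim (pi≢pj (cong p i≡j))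
... | no  i≢j | yes pi≡pj = ⊥-elim (i≢j (p-inj pi≡pj))

quadForm-cong : ∀ {n} {D D′ : Fin n → Fin n → ℕ} → (∀ i j → D i j ≡ D′ i j) → ∀ f → quadForm D f ≡ quadForm D′ f
quadForm-cong D≡D′ f = Σ-cong (λ i → Σ-cong (λ j → cong (λ t → f i * (ℕ→ℚ t * f j)) (D≡D′ i j)))

module Pushforward {k n} (p : Fin k → Fin n) (p-injective : Injective _≡_ _≡_ p) (f : Fin k → ℚ) where

  push : Fin n → ℚ
  push x = Σ[ k ] (λ i → f i * δ (p i) x)

  Σ-push-* : ∀ h → Σ[ n ] (λ x → push x * h x) ≡ Σ[ k ] (λ i → f i * h (p i))
  Σ-push-* h = begin
    Σ[ n ] (λ x → push x * h x)                            ≡⟨ Σ-cong (λ x → Σ-*ʳ {k} (h x) _) ⟩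
    Σ[ n ] (λ x → Σ[ k ] (λ i → f i * δ (p i) x * h x))    ≡⟨ Σ-comm {n} {k} _ ⟩
    Σ[ k ] (λ i → Σ[ n ] (λ x → f i * δ (p i) x * h x))    ≡⟨ Σ-cong (λ i → Σ-cong {n} (λ x → ℚP.*-assoc (f i) _ _)) ⟩
    Σ[ k ] (λ i → Σ[ n ] (λ x → f i * (δ (p i) x * h x)))  ≡⟨ Σ-cong (λ i → Σ-*ˡ {n} (f i) _) ⟨
    Σ[ k ] (λ i → f i * Σ[ n ] (λ x → δ (p i) x * h x))    ≡⟨ Σ-cong (λ i → cong (f i *_) (Σ-δ (p i) h)) ⟩
    Σ[ k ] (λ i → f i * h (p i))                           ∎
    where open ≡-Reasoning

  push-∘ : ∀ j → push (p j) ≡ f j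
  push-∘ j = begin
    Σ[ k ] (λ i → f i * δ (p i) (p j))  ≡⟨ Σ-cong (λ i → cong (f i *_) (trans (δ-injective p p-injective i j) (δ-comm i j))) ⟩
    Σ[ k ] (λ i → f i * δ j i)          ≡⟨ Σ-cong (λ i → ℚP.*-comm (f i) (δ j i)) ⟩
    Σ[ k ] (λ i → δ j i * f i)          ≡⟨ Σ-δ j f ⟩
    f j                                 ∎
    where open ≡-Reasoning

  Σ-push : Σ[ n ] push ≡ Σ[ k ] f
  Σ-push = begin
    Σ[ n ] push                     ≡⟨ Σ-cong (λ x → ℚP.*-identityʳ (push x)) ⟨
    Σ[ n ] (λ x → push x * 1ℚ)      ≡⟨ Σ-push-* (λ _ → 1ℚ) ⟩
    Σ[ k ] (λ i → f i * 1ℚ)         ≡⟨ Σ-cong (λ i → ℚP.*-identityʳ (f i)) ⟩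
    Σ[ k ] f                        ∎
    where open ≡-Reasoning

  normSq-push : normSq push ≡ normSq f
  normSq-push = trans (Σ-push-* push) (Σ-cong (λ i → cong (f i *_) (push-∘ i)))

  quadForm-push : ∀ (D : Fin n → Fin n → ℕ) → quadForm D push ≡ quadForm (λ i j → D (p i) (p j)) f
  quadForm-push D = begin
    Σ[ n ] (λ x → Σ[ n ] (λ y → push x * (d x y * push y)))  ≡⟨ Σ-cong (λ x → Σ-*ˡ {n} (push x) _) ⟨
    Σ[ n ] (λ x → push x * Σ[ n ] (λ y → d x y * push y))    ≡⟨ Σ-push-* _ ⟩
    Σ[ k ] (λ i → f i * Σ[ n ] (λ y → d (p i) y * push y))   ≡⟨ Σ-cong (λ i → cong (f i *_) (pull-back i)) ⟩
    Σ[ k ] (λ i → f i * Σ[ k ] (λ j → f j * d (p i) (p j)))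
      ≡⟨ Σ-cong (λ i → trans (Σ-*ˡ {k} (f i) _) (Σ-cong (λ j → cong (f i *_) (ℚP.*-comm (f j) _)))) ⟩
    Σ[ k ] (λ i → Σ[ k ] (λ j → f i * (d (p i) (p j) * f j)))  ∎
    where
    open ≡-Reasoning
    d : Fin n → Fin n → ℚ
    d x y = ℕ→ℚ (D x y)
    pull-back : ∀ i → Σ[ n ] (λ y → d (p i) y * push y) ≡ Σ[ k ] (λ j → f j * d (p i) (p j))
    pull-back i = trans (Σ-cong (λ y → ℚP.*-comm (d (p i) y) (push y))) (Σ-push-* (d (p i)))

QEC≤-restrict : ∀ {k n} (D : Fin n → Fin n → ℕ) (p : Fin k → Fin n) → Injective _≡_ _≡_ p →
                ∀ q → QEC≤ D q → QEC≤ (λ i j → D (p i) (p j)) q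
QEC≤-restrict D p p-injective q D≤q f Σf≡0 =
  subst₂ ℚ._≤_ (quadForm-push D) (cong (q *_) normSq-push) (D≤q push (trans Σ-push Σf≡0))
  where open Pushforward p p-injective f

QEC≤⇒¬QEC> : ∀ {n} (D : Fin n → Fin n → ℕ) q → QEC≤ D q → ¬ QEC> D q
QEC≤⇒¬QEC> D q D≤q (f , Σf≡0 , qN<Q) = ℚP.<-irrefl refl (ℚP.<-≤-trans qN<Q (D≤q f Σf≡0))

module Graph {n} (G : SimpleGraph n) where

  Adj⇒≢ : ∀ {x y} → Adj G x y → x ≢ y
  Adj⇒≢ {x} a refl with () ← trans (sym a) (irrefl G x)

  Adj-sym : ∀ {x y} → Adj G x y → Adj G y x
  Adj-sym {x} {y} a = trans (SimpleGraph.sym G y x) a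

  infixr 5 _++ʷ_
  _++ʷ_ : ∀ {x y z k l} → Walk G x y k → Walk G y z l → Walk G x z (k ℕ.+ l)
  nil      ++ʷ w′ = w′
  cons a w ++ʷ w′ = cons a (w ++ʷ w′)

  reverseʷ : ∀ {x y k} → Walk G x y k → Walk G y x k
  reverseʷ nil = nil
  reverseʷ {k = suc k} (cons a w) = subst (Walk G _ _) (ℕP.+-comm k 1) (reverseʷ w ++ʷ cons (Adj-sym a) nil)

  vertexAt : ∀ {x y k} → Walk G x y k → ℕ → Fin n
  vertexAt {x} nil        _       = x
  vertexAt {x} (cons _ _) zero    = x
  vertexAt     (cons _ w) (suc i) = vertexAt w i

  vertexAt-0 : ∀ {x y k} (w : Walk G x y k) → vertexAt w 0 ≡ x
  vertexAt-0 nil        = refl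
  vertexAt-0 (cons _ _) = refl

  vertexAt-end : ∀ {x y k} (w : Walk G x y k) → vertexAt w k ≡ y
  vertexAt-end nil        = refl
  vertexAt-end (cons _ w) = vertexAt-end w

IsDist-unique : ∀ {n} {G : SimpleGraph n} {x y k l} → IsDist G x y k → IsDist G x y l → k ≡ l
IsDist-unique (wk , k-min) (wl , l-min) = ℕP.≤-antisym (k-min _ wl) (l-min _ wk)

pathDistance : ∀ {d} → Fin d → Fin d → ℕ
pathDistance i j = ℕ.∣ toℕ i - toℕ j ∣

Path-Adj⇒pathDistance≡1 : ∀ {d} (i j : Fin d) → Adj (Path d) i j → pathDistance i j ≡ 1
Path-Adj⇒pathDistance≡1 0F                    0F                    ()
Path-Adj⇒pathDistance≡1 0F                    1F                    _ = refl
Path-Adj⇒pathDistance≡1 0F                    (Fin.suc (Fin.suc j)) ()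
Path-Adj⇒pathDistance≡1 1F                    0F                    _ = refl
Path-Adj⇒pathDistance≡1 (Fin.suc (Fin.suc i)) 0F                    ()
Path-Adj⇒pathDistance≡1 (Fin.suc i)           (Fin.suc j)           a = Path-Adj⇒pathDistance≡1 i j a

pathDistance≤walk-length : ∀ {d} {i j : Fin d} {k} → Walk (Path d) i j k → pathDistance i j ≤ k
pathDistance≤walk-length {i = i} nil = ℕP.≤-reflexive (ℕP.∣n-n∣≡0 (toℕ i))
pathDistance≤walk-length {i = i} {j} {suc k} (cons {y = y} a w) = begin
  ℕ.∣ toℕ i - toℕ j ∣                          ≤⟨ ℕP.∣-∣-triangle (toℕ i) (toℕ y) (toℕ j) ⟩
  ℕ.∣ toℕ i - toℕ y ∣ ℕ.+ ℕ.∣ toℕ y - toℕ j ∣  ≡⟨ cong (ℕ._+ _) (Path-Adj⇒pathDistance≡1 i y a) ⟩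
  suc ℕ.∣ toℕ y - toℕ j ∣                       ≤⟨ s≤s (pathDistance≤walk-length w) ⟩
  suc k                                        ∎
  where open ℕP.≤-Reasoning

-- Adjacency in Path is computed from toℕ, so shifting by suc preserves it
-- definitionally, and 0F is adjacent to 1F by refl.
Path-walk-suc : ∀ {d} {i j : Fin d} {k} → Walk (Path d) i j k → Walk (Path (suc d)) (Fin.suc i) (Fin.suc j) k
Path-walk-suc nil        = nil
Path-walk-suc (cons a w) = cons a (Path-walk-suc w)

Path-walk-from-0 : ∀ {d} (j : Fin (suc d)) → Walk (Path (suc d)) 0F j (toℕ j)
Path-walk-from-0             0F          = nil
Path-walk-from-0 {d = suc d} (Fin.suc j) = cons refl (Path-walk-suc (Path-walk-from-0 j))

Path-walk : ∀ {d} (i j : Fin d) → Walk (Path d) i j (pathDistance i j)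
Path-walk 0F          j           = Path-walk-from-0 j
Path-walk (Fin.suc i) 0F          = Graph.reverseʷ (Path _) (Path-walk-from-0 (Fin.suc i))
Path-walk (Fin.suc i) (Fin.suc j) = Path-walk-suc (Path-walk i j)

Path-dist≡pathDistance : ∀ {d} {DP : Fin d → Fin d → ℕ} → IsDistMatrix (Path d) DP → ∀ i j → DP i j ≡ pathDistance i j
Path-dist≡pathDistance DP-dist i j = IsDist-unique (DP-dist i j) (Path-walk i j , λ _ → pathDistance≤walk-length)

square-nonNeg : ∀ x → 0ℚ ℚ.≤ x * x
square-nonNeg x with ℚP.≤-total 0ℚ x
... | inj₁ 0≤x = ℚP.nonNegative⁻¹ _ {{ℚP.nonNeg*nonNeg⇒nonNeg x {{ℚ.nonNegative 0≤x}} x {{ℚ.nonNegative 0≤x}}}}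
... | inj₂ x≤0 = ℚP.nonNegative⁻¹ _ {{ℚP.nonPos*nonPos⇒nonPos x {{ℚ.nonPositive x≤0}} x {{ℚ.nonPositive x≤0}}}}

twice : ℚ → ℚ
twice x = x + x

moment : ∀ {d} → (Fin d → ℚ) → ℚ
moment {d} f = Σ[ d ] (λ i → ℕ→ℚ (toℕ i) * f i)

module PathStep {d} (f : Fin (suc d) → ℚ) where

  f₀ : ℚ
  f₀ = f 0F

  f′ : Fin d → ℚ
  f′ = f ∘ Fin.suc

  shifted-moment : Σ[ d ] (λ i → ℕ→ℚ (suc (toℕ i)) * f′ i) ≡ moment f′ + Σ[ d ] f′
  shifted-moment = begin
    Σ[ d ] (λ i → ℕ→ℚ (suc (toℕ i)) * f′ i)          ≡⟨ Σ-cong (λ i → cong (_* f′ i) (ℕ→ℚ-suc (toℕ i))) ⟩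
    Σ[ d ] (λ i → (ℕ→ℚ (toℕ i) + 1ℚ) * f′ i)
      ≡⟨ Σ-cong (λ i → solve 2 (λ t x → (t :+ con 1ℚ) :* x := t :* x :+ x) refl (ℕ→ℚ (toℕ i)) (f′ i)) ⟩
    Σ[ d ] (λ i → ℕ→ℚ (toℕ i) * f′ i + f′ i)         ≡⟨ Σ-+ _ f′ ⟩
    moment f′ + Σ[ d ] f′                            ∎
    where open ≡-Reasoning

  moment-suc : moment f ≡ moment f′ + Σ[ d ] f′
  moment-suc = trans (cong (0ℚ * f₀ +_) shifted-moment) (solve 2 (λ a m → con 0ℚ :* a :+ m := m) refl f₀ _)

  cross-term : Σ[ d ] (λ i → f₀ * (ℕ→ℚ (suc (toℕ i)) * f′ i)) ≡ f₀ * (moment f′ + Σ[ d ] f′)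
  cross-term = trans (sym (Σ-*ˡ {d} f₀ _)) (cong (f₀ *_) shifted-moment)

  quadForm-suc : quadForm pathDistance f ≡ twice (f₀ * (moment f′ + Σ[ d ] f′)) + quadForm pathDistance f′
  quadForm-suc = begin
    (f₀ * (0ℚ * f₀) + Σ[ d ] (λ i → f₀ * (w i * f′ i)))
      + Σ[ d ] (λ i → f′ i * (w i * f₀) + Σ[ d ] (λ j → f′ i * (ℕ→ℚ (pathDistance i j) * f′ j)))
        ≡⟨ cong₂ (λ a b → (f₀ * (0ℚ * f₀) + a) + b) cross-term
             (trans (Σ-+ {d} _ _) (cong (_+ quadForm pathDistance f′) (trans (Σ-cong swap) cross-term))) ⟩
    (f₀ * (0ℚ * f₀) + c) + (c + quadForm pathDistance f′)
        ≡⟨ solve 3 (λ a c q → (a :* (con 0ℚ :* a) :+ c) :+ (c :+ q) := (c :+ c) :+ q) refl f₀ c _ ⟩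
    twice c + quadForm pathDistance f′  ∎
    where
    open ≡-Reasoning
    w : Fin d → ℚ
    w i = ℕ→ℚ (suc (toℕ i))
    c : ℚ
    c = f₀ * (moment f′ + Σ[ d ] f′)
    swap : ∀ i → f′ i * (w i * f₀) ≡ f₀ * (w i * f′ i)
    swap i = solve 3 (λ x t a → x :* (t :* a) := a :* (t :* x)) refl (f′ i) (w i) f₀

-- Passing from f ∘ suc to f, the right-hand side gains the same terms as the
-- left-hand side plus the square (f₀ + 2 Σ f′)².
path-quadForm-bound : ∀ {d} (f : Fin d → ℚ) →
  twice (quadForm pathDistance f) + normSq f ℚ.≤ twice (Σ[ d ] f * (Σ[ d ] f + twice (moment f)))
path-quadForm-bound {zero}  f = ℚP.≤-refl
path-quadForm-bound {suc d} f = begin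
  twice Q + (f₀ * f₀ + N′)                    ≡⟨ cong (λ q → twice q + (f₀ * f₀ + N′)) quadForm-suc ⟩
  twice (twice c + Q′) + (f₀ * f₀ + N′)       ≡⟨ solve 4 (λ a c q n → ((c :+ c) :+ q) :+ ((c :+ c) :+ q) :+ (a :* a :+ n)
                                                           := ((q :+ q) :+ n) :+ (((c :+ c) :+ (c :+ c)) :+ a :* a))
                                                   refl f₀ c Q′ N′ ⟩
  (twice Q′ + N′) + E                         ≤⟨ ℚP.+-monoˡ-≤ E (path-quadForm-bound f′) ⟩
  R′ + E                                      ≡⟨ ℚP.+-identityʳ (R′ + E) ⟨
  (R′ + E) + 0ℚ                               ≤⟨ ℚP.+-monoʳ-≤ (R′ + E) (square-nonNeg (f₀ + twice S′)) ⟩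
  (R′ + E) + (f₀ + twice S′) * (f₀ + twice S′)      ≡⟨ solve 3 (λ a s m →
       ((s :* (s :+ (m :+ m)) :+ s :* (s :+ (m :+ m))) :+ (((a :* (m :+ s) :+ a :* (m :+ s)) :+ (a :* (m :+ s) :+ a :* (m :+ s))) :+ a :* a))
         :+ (a :+ (s :+ s)) :* (a :+ (s :+ s))
       := (a :+ s) :* ((a :+ s) :+ ((m :+ s) :+ (m :+ s))) :+ (a :+ s) :* ((a :+ s) :+ ((m :+ s) :+ (m :+ s))))
       refl f₀ S′ M′ ⟩
  twice ((f₀ + S′) * ((f₀ + S′) + twice (M′ + S′)))
      ≡⟨ cong (λ m → twice ((f₀ + S′) * ((f₀ + S′) + twice m))) moment-suc ⟨
  twice ((f₀ + S′) * ((f₀ + S′) + twice M))         ∎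
  where
  open PathStep f
  open ℚP.≤-Reasoning
  Q = quadForm pathDistance f
  Q′ = quadForm pathDistance f′
  N′ = normSq f′
  S′ = Σ[ d ] f′
  M′ = moment f′
  M = moment f
  c = f₀ * (M′ + S′)
  E = twice (twice c) + f₀ * f₀
  R′ = twice (S′ * (S′ + twice M′))

QEC>-Path⇒<-½ : ∀ {d} {DP : Fin d → Fin d → ℕ} → IsDistMatrix (Path d) DP → ∀ q → QEC> DP q → twice q + 1ℚ ℚ.< 0ℚ
QEC>-Path⇒<-½ {d} {DP} DP-dist q (f , Σf≡0 , qN<Q) = ℚP.≰⇒> λ 0≤2q+1 → ℚP.<-irrefl refl (begin-strict
  0ℚ                         ≤⟨ ℚP.nonNegative⁻¹ _ {{ℚP.nonNeg*nonNeg⇒nonNeg (twice q + 1ℚ) {{ℚ.nonNegative 0≤2q+1}}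
                                                                             N {{ℚ.nonNegative N≥0}}}} ⟩
  (twice q + 1ℚ) * N         ≡⟨ solve 2 (λ q n → ((q :+ q) :+ con 1ℚ) :* n := (q :* n :+ q :* n) :+ n) refl q N ⟩
  twice (q * N) + N          <⟨ ℚP.+-monoˡ-< N (ℚP.+-mono-< qN<Q′ qN<Q′) ⟩
  twice Q + N                ≤⟨ path-quadForm-bound f ⟩
  twice (Σ[ d ] f * (Σ[ d ] f + twice (moment f)))
                             ≡⟨ cong (λ s → twice (s * (s + twice (moment f)))) Σf≡0 ⟩
  twice (0ℚ * (0ℚ + twice (moment f)))
                             ≡⟨ solve 1 (λ m → (con 0ℚ :* (con 0ℚ :+ (m :+ m))) :+ (con 0ℚ :* (con 0ℚ :+ (m :+ m)))
                                               := con 0ℚ) refl (moment f) ⟩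
  0ℚ                         ∎)
  where
  open ℚP.≤-Reasoning
  N = normSq f
  Q = quadForm pathDistance f
  N≥0 : 0ℚ ℚ.≤ N
  N≥0 = Σ-nonNeg _ (λ i → square-nonNeg (f i))
  qN<Q′ : q * N ℚ.< Q
  qN<Q′ = subst (q * N ℚ.<_) (quadForm-cong (Path-dist≡pathDistance DP-dist) f) qN<Q

module Distance {n} {G : SimpleGraph n} {D : Fin n → Fin n → ℕ} (D-dist : IsDistMatrix G D) where
  open Graph G

  geodesic : ∀ x y → Walk G x y (D x y)
  geodesic x y = proj₁ (D-dist x y)

  D-minimal : ∀ {x y k} → Walk G x y k → D x y ≤ k
  D-minimal w = proj₂ (D-dist _ _) _ w

  D-refl : ∀ x → D x x ≡ 0
  D-refl x = ℕP.n≤0⇒n≡0 (D-minimal nil)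

  D≡0⇒≡ : ∀ {x y} → D x y ≡ 0 → x ≡ y
  D≡0⇒≡ {x} {y} D≡0 with nil ← subst (Walk G x y) D≡0 (geodesic x y) = refl

  D-sym : ∀ x y → D x y ≡ D y x
  D-sym x y = ℕP.≤-antisym (D-minimal (reverseʷ (geodesic y x))) (D-minimal (reverseʷ (geodesic x y)))

  D-triangle : ∀ x y z → D x z ≤ D x y ℕ.+ D y z
  D-triangle x y z = D-minimal (geodesic x y ++ʷ geodesic y z)

  D≡suc⇒≢ : ∀ {x y k} → D x y ≡ suc k → x ≢ y
  D≡suc⇒≢ {x} D≡suc refl with () ← trans (sym D≡suc) (D-refl x)

  Adj⇒D≡1 : ∀ {x y} → Adj G x y → D x y ≡ 1
  Adj⇒D≡1 {x} {y} a with D x y in eq | D-minimal (cons a nil)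
  ... | 0                 | _       = ⊥-elim (Adj⇒≢ a (D≡0⇒≡ eq))
  ... | 1                 | _       = refl
  ... | suc (suc _)       | s≤s ()

  D≡1⇒Adj : ∀ {x y} → D x y ≡ 1 → Adj G x y
  D≡1⇒Adj {x} {y} D≡1 with cons a nil ← subst (Walk G x y) D≡1 (geodesic x y) = a

  ≢∧¬Adj⇒2≤D : ∀ {x y} → x ≢ y → ¬ Adj G x y → 2 ≤ D x y
  ≢∧¬Adj⇒2≤D {x} {y} x≢y ¬a with D x y in eq
  ... | 0           = ⊥-elim (x≢y (D≡0⇒≡ eq))
  ... | 1           = ⊥-elim (¬a (D≡1⇒Adj eq))
  ... | suc (suc _) = s≤s (s≤s z≤n)

  D-Adj-triangleˡ : ∀ {x y} z → Adj G x y → D x z ≤ suc (D y z)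
  D-Adj-triangleˡ {x} {y} z a = subst (λ t → D x z ≤ t ℕ.+ D y z) (Adj⇒D≡1 a) (D-triangle x y z)

  D-Adj-triangleʳ : ∀ x {y z} → Adj G y z → D x z ≤ suc (D x y)
  D-Adj-triangleʳ x {y} {z} a = begin
    D x z             ≤⟨ D-triangle x y z ⟩
    D x y ℕ.+ D y z   ≡⟨ cong (D x y ℕ.+_) (Adj⇒D≡1 a) ⟩
    D x y ℕ.+ 1       ≡⟨ ℕP.+-comm (D x y) 1 ⟩
    suc (D x y)       ∎
    where open ℕP.≤-Reasoning

  D-neighbour≥ : ∀ {x x′ z k} → Adj G x x′ → D x z ≡ suc k → k ≤ D x′ z
  D-neighbour≥ {x} {x′} {z} a x→z = ℕP.≤-pred (subst (_≤ suc (D x′ z)) x→z (D-Adj-triangleˡ z a))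

  geodesic-step : ∀ {x y k} → D x y ≡ suc k → ∃ λ x′ → Adj G x x′ × D x′ y ≡ k
  geodesic-step {x} {y} {k} D≡suc with cons {y = x′} a w ← subst (Walk G x y) D≡suc (geodesic x y) =
    x′ , a , ℕP.≤-antisym (D-minimal w) (D-neighbour≥ a D≡suc)

  vertexAt-dist : ∀ {x y k} (w : Walk G x y k) {i j} → i ≤ j → j ≤ k →
                  D (vertexAt w i) (vertexAt w j) ≤ j ∸ i
  vertexAt-dist {x} nil                  _       _         = ℕP.≤-trans (ℕP.≤-reflexive (D-refl x)) z≤n
  vertexAt-dist {x} (cons a w) {zero}  {zero}  _ _         = ℕP.≤-reflexive (D-refl x)
  vertexAt-dist {x} (cons a w) {zero}  {suc j} _ (s≤s j≤k) = ℕP.≤-trans (D-Adj-triangleˡ _ a)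
    (s≤s (subst (λ v → D v (vertexAt w j) ≤ j) (vertexAt-0 w) (vertexAt-dist w z≤n j≤k)))
  vertexAt-dist (cons a w) {suc i} {suc j} (s≤s i≤j) (s≤s j≤k) = vertexAt-dist w i≤j j≤k

  geodesic-isometric : ∀ {x y} (w : Walk G x y (D x y)) {i j} → i ≤ j → j ≤ D x y →
                       D (vertexAt w i) (vertexAt w j) ≡ j ∸ i
  geodesic-isometric {x} {y} w {i} {j} i≤j j≤k = ℕP.≤-antisym (vertexAt-dist w i≤j j≤k) (ℕP.m≤n+o⇒m∸n≤o j i j≤i+A)
    where
    A = D (vertexAt w i) (vertexAt w j)
    x→i : D x (vertexAt w i) ≤ i
    x→i = subst (λ v → D v (vertexAt w i) ≤ i) (vertexAt-0 w) (vertexAt-dist w z≤n (ℕP.≤-trans i≤j j≤k))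
    j→y : D (vertexAt w j) y ≤ D x y ∸ j
    j→y = subst (λ v → D (vertexAt w j) v ≤ D x y ∸ j) (vertexAt-end w) (vertexAt-dist w j≤k ℕP.≤-refl)
    j≤i+A : j ≤ i ℕ.+ A
    j≤i+A = ℕP.+-cancelʳ-≤ (D x y ∸ j) j (i ℕ.+ A) (begin
      j ℕ.+ (D x y ∸ j)                                       ≡⟨ ℕP.m+[n∸m]≡n j≤k ⟩
      D x y                                                   ≤⟨ D-triangle x (vertexAt w j) y ⟩
      D x (vertexAt w j) ℕ.+ D (vertexAt w j) y               ≤⟨ ℕP.+-mono-≤ (D-triangle x (vertexAt w i) (vertexAt w j)) j→y ⟩
      D x (vertexAt w i) ℕ.+ A ℕ.+ (D x y ∸ j)                ≤⟨ ℕP.+-monoˡ-≤ (D x y ∸ j) (ℕP.+-monoˡ-≤ A x→i) ⟩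
      i ℕ.+ A ℕ.+ (D x y ∸ j)                                 ∎)
      where open ℕP.≤-Reasoning

  Path-embedding : ∀ {d} x y → d ≤ suc (D x y) →
                   ∃ λ (p : Fin d → Fin n) → ∀ i j → D (p i) (p j) ≡ pathDistance i j
  Path-embedding x y d≤1+D = (λ i → vertexAt w (toℕ i)) , embedding
    where
    w = geodesic x y
    on-geodesic : ∀ {d} (i : Fin d) → d ≤ suc (D x y) → toℕ i ≤ D x y
    on-geodesic i d≤ = ℕP.≤-pred (ℕP.≤-trans (FinP.toℕ<n i) d≤)
    embedding : ∀ i j → D (vertexAt w (toℕ i)) (vertexAt w (toℕ j)) ≡ pathDistance i j
    embedding i j with ℕP.≤-total (toℕ i) (toℕ j)
    ... | inj₁ i≤j = trans (geodesic-isometric w i≤j (on-geodesic j d≤1+D)) (sym (ℕP.m≤n⇒∣m-n∣≡n∸m i≤j))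
    ... | inj₂ j≤i = trans (D-sym _ _) (trans (geodesic-isometric w j≤i (on-geodesic i d≤1+D)) (sym (ℕP.m≤n⇒∣n-m∣≡n∸m j≤i)))

QEC≤-isometric : ∀ {k n} (D : Fin n → Fin n → ℕ) (D′ : Fin k → Fin k → ℕ) (p : Fin k → Fin n) →
                 (∀ x → D x x ≡ 0) → (∀ i j → D′ i j ≡ 0 → i ≡ j) → (∀ i j → D (p i) (p j) ≡ D′ i j) →
                 ∀ q → QEC≤ D q → QEC≤ D′ q
QEC≤-isometric D D′ p D-refl D′-separates p-isometric q D≤q f Σf≡0 =
  subst (ℚ._≤ q * normSq f) (quadForm-cong {D = λ i j → D (p i) (p j)} p-isometric f) (QEC≤-restrict D p p-injective q D≤q f Σf≡0)
  where
  p-injective : Injective _≡_ _≡_ p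
  p-injective {i} {j} pi≡pj =
    D′-separates i j (trans (sym (p-isometric i j)) (trans (cong (D (p i)) (sym pi≡pj)) (D-refl (p i))))

pathDistance-separates : ∀ {d} (i j : Fin d) → pathDistance i j ≡ 0 → i ≡ j
pathDistance-separates i j ∣i-j∣≡0 = FinP.toℕ-injective (ℕP.∣m-n∣≡0⇒m≡n ∣i-j∣≡0)

QEC<Path⇒diam≤ : ∀ {n d} {G : SimpleGraph n} {D : Fin n → Fin n → ℕ} {DP : Fin d → Fin d → ℕ} →
                 IsDistMatrix G D → IsDistMatrix (Path d) DP → QEC< D DP → DiamLe D (d ∸ 2)
QEC<Path⇒diam≤ {d = d} {D = D} {DP} D-dist DP-dist (q , D≤q , DP>q) x y with D x y ℕP.≤? d ∸ 2
... | yes D≤d-2 = D≤d-2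
... | no  D≰d-2 = ⊥-elim (QEC≤⇒¬QEC> DP q DP≤q DP>q)
  where
  open Distance D-dist using (D-refl; Path-embedding)
  d≤1+D : d ≤ suc (D x y)
  d≤1+D = ℕP.≤-trans (ℕP.m≤n+m∸n d 2) (s≤s (ℕP.≰⇒> D≰d-2))
  DP≤q : QEC≤ DP q
  DP≤q with p , p-isometric ← Path-embedding x y d≤1+D =
    QEC≤-isometric D DP p D-refl DP-separates (λ i j → trans (p-isometric i j) (sym (Path-dist≡pathDistance DP-dist i j))) q D≤q
    where
    DP-separates : ∀ i j → DP i j ≡ 0 → i ≡ j
    DP-separates i j DP≡0 = pathDistance-separates i j (trans (sym (Path-dist≡pathDistance DP-dist i j)) DP≡0)

-- On concrete indices this reduces to the six entries above the diagonal, so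
-- the quadratic form of a 4 × 4 distance matrix becomes a polynomial in them.
upperSymmetric : ∀ {n} → (Fin n → Fin n → ℕ) → Fin n → Fin n → ℕ
upperSymmetric E i j with FinP.<-cmp i j
... | tri< _ _ _ = E i j
... | tri≈ _ _ _ = 0
... | tri> _ _ _ = E j i

≡upperSymmetric : ∀ {n} {E : Fin n → Fin n → ℕ} → (∀ i j → E i j ≡ E j i) → (∀ i → E i i ≡ 0) →
                  ∀ i j → E i j ≡ upperSymmetric E i j
≡upperSymmetric E-sym E-refl i j with FinP.<-cmp i j
... | tri< _ _    _ = refl
... | tri≈ _ refl _ = E-refl i
... | tri> _ _    _ = E-sym i j

alternating : Fin 4 → ℚ
alternating 0F = 1ℚ
alternating 1F = - 1ℚ
alternating 2F = 1ℚ
alternating 3F = - 1ℚ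

quadForm-alternating : (E : Fin 4 → Fin 4 → ℕ) →
  let e : Fin 4 → Fin 4 → ℚ
      e i j = ℕ→ℚ (E i j)
  in quadForm (upperSymmetric E) alternating ≡
     twice (e 0F 2F + e 1F 3F) + - twice (((e 0F 1F + e 1F 2F) + e 2F 3F) + e 0F 3F)
quadForm-alternating E = solve 6 (λ a b c d e f →
  let o = con 1ℚ ; m = :- con 1ℚ ; z = con 0ℚ in
    (o :* (z :* o) :+ (o :* (a :* m) :+ (o :* (b :* o) :+ (o :* (c :* m) :+ z)))) :+
    ((m :* (a :* o) :+ (m :* (z :* m) :+ (m :* (d :* o) :+ (m :* (e :* m) :+ z)))) :+
    ((o :* (b :* o) :+ (o :* (d :* m) :+ (o :* (z :* o) :+ (o :* (f :* m) :+ z)))) :+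
    ((m :* (c :* o) :+ (m :* (e :* m) :+ (m :* (f :* o) :+ (m :* (z :* m) :+ z)))) :+ z)))
  := (b :+ e) :+ (b :+ e) :+ :- ((((a :+ d) :+ f) :+ c) :+ (((a :+ d) :+ f) :+ c)))
  refl (e 0F 1F) (e 0F 2F) (e 0F 3F) (e 1F 2F) (e 1F 3F) (e 2F 3F)
  where
  e : Fin 4 → Fin 4 → ℚ
  e i j = ℕ→ℚ (E i j)

module Quadrilateral {n} {D : Fin n → Fin n → ℕ} (D-sym : ∀ x y → D x y ≡ D y x) (D-refl : ∀ x → D x x ≡ 0)
         (q : ℚ) (D≤q : QEC≤ D q) (q<-½ : twice q + 1ℚ ℚ.< 0ℚ) where

  no-short-quadrilateral : ∀ {p₀ p₁ p₂ p₃} → p₀ ≢ p₁ → p₀ ≢ p₂ → p₀ ≢ p₃ → p₁ ≢ p₂ → p₁ ≢ p₃ → p₂ ≢ p₃ →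
    ¬ (D p₀ p₁ ℕ.+ D p₁ p₂ ℕ.+ D p₂ p₃ ℕ.+ D p₃ p₀ ≤ D p₀ p₂ ℕ.+ D p₁ p₃ ℕ.+ 1)
  no-short-quadrilateral {p₀} {p₁} {p₂} {p₃} p₀≢p₁ p₀≢p₂ p₀≢p₃ p₁≢p₂ p₁≢p₃ p₂≢p₃ P≤Δ+1 =
    -- Twice (P ≤ Δ + 1), plus (2Δ - 2P ≤ 4q), plus twice (2q + 1 < 0) reads 4q + 2 < 4q + 2.
    ℚP.<-irrefl (solve 3 (λ q P Δ → (P :+ P) :+ ((Δ :+ Δ) :+ :- (P :+ P)) :+ (((q :+ q) :+ con 1ℚ) :+ ((q :+ q) :+ con 1ℚ))
                                 := ((Δ :+ con 1ℚ) :+ (Δ :+ con 1ℚ)) :+ q :* (((con 1ℚ :+ con 1ℚ) :+ con 1ℚ) :+ con 1ℚ) :+ (con 0ℚ :+ con 0ℚ))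
                          refl q P Δ)
      (ℚP.+-mono-≤-< (ℚP.+-mono-≤ (ℚP.+-mono-≤ P≤Δ+1ℚ P≤Δ+1ℚ) 2Δ-2P≤4q) (ℚP.+-mono-< q<-½ q<-½))
    where
    ps = p₀ ∷ p₁ ∷ p₂ ∷ p₃ ∷ []
    p : Fin 4 → Fin n
    p = lookup ps
    ps-unique : Unique ps
    ps-unique = (p₀≢p₁ ∷ p₀≢p₂ ∷ p₀≢p₃ ∷ []) ∷ (p₁≢p₂ ∷ p₁≢p₃ ∷ []) ∷ (p₂≢p₃ ∷ []) ∷ [] ∷ []
    e : Fin n → Fin n → ℚ
    e x y = ℕ→ℚ (D x y)
    P = ((e p₀ p₁ + e p₁ p₂) + e p₂ p₃) + e p₀ p₃
    Δ = e p₀ p₂ + e p₁ p₃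
    2Δ-2P≤4q : twice Δ + - twice P ℚ.≤ q * (((1ℚ + 1ℚ) + 1ℚ) + 1ℚ)
    2Δ-2P≤4q = subst (ℚ._≤ _)
      (trans (quadForm-cong (≡upperSymmetric (λ i j → D-sym (p i) (p j)) (D-refl ∘ p)) alternating)
             (quadForm-alternating (λ i j → D (p i) (p j))))
      (QEC≤-restrict D p (lookup-injective ps-unique _ _) q D≤q alternating refl)
    P≤Δ+1ℚ : P ℚ.≤ Δ + 1ℚ
    P≤Δ+1ℚ = subst₂ ℚ._≤_ perimeter diagonals (ℕ→ℚ-mono-≤ P≤Δ+1)
      where
      perimeter : ℕ→ℚ (D p₀ p₁ ℕ.+ D p₁ p₂ ℕ.+ D p₂ p₃ ℕ.+ D p₃ p₀) ≡ P
      perimeter = begin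
        ℕ→ℚ (D p₀ p₁ ℕ.+ D p₁ p₂ ℕ.+ D p₂ p₃ ℕ.+ D p₃ p₀)
          ≡⟨ ℕ→ℚ-+ (D p₀ p₁ ℕ.+ D p₁ p₂ ℕ.+ D p₂ p₃) (D p₃ p₀) ⟩
        ℕ→ℚ (D p₀ p₁ ℕ.+ D p₁ p₂ ℕ.+ D p₂ p₃) + e p₃ p₀
          ≡⟨ cong₂ _+_ (ℕ→ℚ-+ (D p₀ p₁ ℕ.+ D p₁ p₂) (D p₂ p₃)) (cong ℕ→ℚ (D-sym p₃ p₀)) ⟩
        (ℕ→ℚ (D p₀ p₁ ℕ.+ D p₁ p₂) + e p₂ p₃) + e p₀ p₃
          ≡⟨ cong (λ t → (t + e p₂ p₃) + e p₀ p₃) (ℕ→ℚ-+ (D p₀ p₁) (D p₁ p₂)) ⟩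
        P ∎
        where open ≡-Reasoning
      diagonals : ℕ→ℚ (D p₀ p₂ ℕ.+ D p₁ p₃ ℕ.+ 1) ≡ Δ + 1ℚ
      diagonals = trans (ℕ→ℚ-+ (D p₀ p₂ ℕ.+ D p₁ p₃) 1) (cong (_+ 1ℚ) (ℕ→ℚ-+ (D p₀ p₂) (D p₁ p₃)))

module Cliques {n} (G : SimpleGraph n) where
  open Graph G

  Adj? : ∀ x y → Dec (Adj G x y)
  Adj? x y = adj G x y Bool.≟ true

  Adjacent-to-all : Fin n → Subset n → Set
  Adjacent-to-all v K = ∀ c → c ∈ K → Adj G v c

  ∪-clique : ∀ {K v} → IsClique G K → Adjacent-to-all v K → IsClique G (⁅ v ⁆ ∪ K)
  ∪-clique {K} {v} K-clique v~K x y x∈ y∈ x≢y with SubsetP.x∈p∪q⁻ ⁅ v ⁆ K x∈ | SubsetP.x∈p∪q⁻ ⁅ v ⁆ K y∈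
  ... | inj₁ x∈v | inj₁ y∈v = ⊥-elim (x≢y (trans (SubsetP.x∈⁅y⁆⇒x≡y v x∈v) (sym (SubsetP.x∈⁅y⁆⇒x≡y v y∈v))))
  ... | inj₁ x∈v | inj₂ y∈K = subst (λ z → Adj G z y) (sym (SubsetP.x∈⁅y⁆⇒x≡y v x∈v)) (v~K y y∈K)
  ... | inj₂ x∈K | inj₁ y∈v = subst (Adj G x) (sym (SubsetP.x∈⁅y⁆⇒x≡y v y∈v)) (Adj-sym (v~K x x∈K))
  ... | inj₂ x∈K | inj₂ y∈K = K-clique x y x∈K y∈K x≢y

  edge-clique : ∀ {u v} → Adj G u v → IsClique G (⁅ u ⁆ ∪ ⁅ v ⁆)
  edge-clique {u} {v} a = ∪-clique singleton (λ c c∈v → subst (Adj G u) (sym (SubsetP.x∈⁅y⁆⇒x≡y v c∈v)) a)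
    where
    singleton : IsClique G ⁅ v ⁆
    singleton x y x∈ y∈ x≢y = ⊥-elim (x≢y (trans (SubsetP.x∈⁅y⁆⇒x≡y v x∈) (sym (SubsetP.x∈⁅y⁆⇒x≡y v y∈))))

  maximal-excludes : ∀ {K v} → IsMaximalClique G K → v ∉ K → ∃ λ c → c ∈ K × ¬ Adj G v c
  maximal-excludes {K} {v} (K-clique , K-maximal) v∉K
    with FinP.any? (λ c → (c SubsetP.∈? K) ×-dec ¬? (Adj? v c))
  ... | yes (c , c∈K , ¬a) = c , c∈K , ¬a
  ... | no  none = ⊥-elim (v∉K (K-maximal (⁅ v ⁆ ∪ K) (∪-clique K-clique v~K) (SubsetP.q⊆p∪q ⁅ v ⁆ K)
                                 (SubsetP.x∈p∪q⁺ (inj₁ (SubsetP.x∈⁅x⁆ v)))))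
    where
    v~K : Adjacent-to-all v K
    v~K c c∈K = decidable-stable (Adj? v c) (λ ¬a → none (c , c∈K , ¬a))

  maximal-nonempty : ∀ {K} → IsMaximalClique G K → Fin n → ∃ (_∈ K)
  maximal-nonempty {K} K-max v with v SubsetP.∈? K
  ... | yes v∈K = v , v∈K
  ... | no  v∉K = let c , c∈K , _ = maximal-excludes K-max v∉K in c , c∈K

  maximal-has-second : ∀ {K x v} → IsMaximalClique G K → x ∈ K → Adj G x v → ∃ λ a → a ∈ K × a ≢ x
  maximal-has-second {K} {x} {v} K-max x∈K a with v SubsetP.∈? K
  ... | yes v∈K = v , v∈K , (Adj⇒≢ a ∘ sym)
  ... | no  v∉K = let c , c∈K , ¬a = maximal-excludes K-max v∉K
                  in c , c∈K , λ c≡x → ¬a (subst (Adj G v) (sym c≡x) (Adj-sym a))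

  maximal-⊈ : ∀ {C C′} → IsMaximalClique G C → IsClique G C′ → C ≢ C′ → ∃ λ a → a ∈ C × a ∉ C′
  maximal-⊈ {C} {C′} (_ , C-maximal) C′-clique C≢C′
    with FinP.any? (λ a → (a SubsetP.∈? C) ×-dec ¬? (a SubsetP.∈? C′))
  ... | yes (a , a∈C , a∉C′) = a , a∈C , a∉C′
  ... | no  none = ⊥-elim (C≢C′ (SubsetP.⊆-antisym C⊆C′ (C-maximal C′ C′-clique C⊆C′)))
    where
    C⊆C′ : C ⊆ C′
    C⊆C′ {a} a∈C = decidable-stable (a SubsetP.∈? C′) (λ a∉C′ → none (a , a∈C , a∉C′))

  maximal-or-extendable : ∀ {K} → IsClique G K → IsMaximalClique G K ⊎ ∃ λ v → v ∉ K × Adjacent-to-all v K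
  maximal-or-extendable {K} K-clique
    with FinP.any? (λ v → ¬? (v SubsetP.∈? K) ×-dec FinP.all? (λ c → (c SubsetP.∈? K) →-dec Adj? v c))
  ... | yes (v , v∉K , v~K) = inj₂ (v , v∉K , v~K)
  ... | no  none = inj₁ (K-clique , K-maximal)
    where
    K-maximal : ∀ C → IsClique G C → K ⊆ C → C ⊆ K
    K-maximal C C-clique K⊆C {v} v∈C with v SubsetP.∈? K
    ... | yes v∈K = v∈K
    ... | no  v∉K = ⊥-elim (none (v , v∉K , λ c c∈K →
                      C-clique v c v∈C (K⊆C c∈K) (λ v≡c → v∉K (subst (_∈ K) (sym v≡c) c∈K))))

  extend-to-maximal : ∀ {K} → IsClique G K → ∃ λ K′ → IsMaximalClique G K′ × K ⊆ K′
  extend-to-maximal {K} = extend (n ∸ ∣ K ∣) ℕP.≤-refl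
    where
    extend : ∀ {K} k → n ∸ ∣ K ∣ ≤ k → IsClique G K → ∃ λ K′ → IsMaximalClique G K′ × K ⊆ K′
    extend {K} k bound K-clique with maximal-or-extendable K-clique
    ... | inj₁ K-max = K , K-max , id
    ... | inj₂ (v , v∉K , v~K) = grow k (ℕP.<-≤-trans shrinks bound)
      where
      K⊆K′ : K ⊆ ⁅ v ⁆ ∪ K
      K⊆K′ = SubsetP.q⊆p∪q ⁅ v ⁆ K
      shrinks : n ∸ ∣ ⁅ v ⁆ ∪ K ∣ ℕ.< n ∸ ∣ K ∣
      shrinks = ℕP.∸-monoʳ-< (SubsetP.p⊂q⇒∣p∣<∣q∣ (K⊆K′ , v , SubsetP.x∈p∪q⁺ (inj₁ (SubsetP.x∈⁅x⁆ v)) , v∉K))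
                             (SubsetP.∣p∣≤n (⁅ v ⁆ ∪ K))
      grow : ∀ k → n ∸ ∣ ⁅ v ⁆ ∪ K ∣ ℕ.< k → ∃ λ K′ → IsMaximalClique G K′ × K ⊆ K′
      grow (suc k) (s≤s bound′) =
        let K′ , K′-max , K∪v⊆K′ = extend k bound′ (∪-clique K-clique v~K) in K′ , K′-max , K∪v⊆K′ ∘ K⊆K′

squeeze : ∀ {m k} → m ≤ k → k ≤ suc m → k ≢ m → k ≡ suc m
squeeze m≤k k≤1+m k≢m = ℕP.≤-antisym k≤1+m (ℕP.≤∧≢⇒< m≤k (k≢m ∘ sym))

module _ {A : Set} (∃? : ∀ {P : A → Set} → Decidable P → Dec (∃ P)) where

  argmin : ∀ {P : A → Set} → Decidable P → (h : A → ℕ) → ∃ P → ∃ λ a → P a × (∀ b → P b → h a ≤ h b)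
  argmin {P} P? h (a , Pa) = descend (h a) a Pa ℕP.≤-refl
    where
    descend : ∀ k a → P a → h a ≤ k → ∃ λ a → P a × (∀ b → P b → h a ≤ h b)
    descend k a Pa ha≤k with ∃? (λ b → P? b ×-dec (h b ℕP.<? h a))
    ... | no  ∄lower = a , Pa , λ b Pb → ℕP.≮⇒≥ (λ hb<ha → ∄lower (b , Pb , hb<ha))
    ... | yes (b , Pb , hb<ha) with k
    ...   | zero   = ⊥-elim (ℕP.n≮0 (ℕP.<-≤-trans hb<ha ha≤k))
    ...   | suc k′ = descend k′ b Pb (ℕP.≤-pred (ℕP.≤-trans hb<ha ha≤k))

module CliqueGeometry {n} {G : SimpleGraph n} {D : Fin n → Fin n → ℕ} (D-dist : IsDistMatrix G D)
                      (q : ℚ) (D≤q : QEC≤ D q) (q<-½ : twice q + 1ℚ ℚ.< 0ℚ) where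
  open Graph G
  open Distance D-dist
  open Cliques G
  open Quadrilateral D-sym D-refl q D≤q q<-½

  CommonNeighbourWithin : ℕ → Fin n → Fin n → Fin n → Set
  CommonNeighbourWithin e v c₁ c₂ = ∃ λ w → Adj G w c₁ × Adj G w c₂ × D w v ≤ e

  step-closer : ∀ {e v v′ c₁ c₂} → Adj G v v′ → CommonNeighbourWithin e v′ c₁ c₂ → CommonNeighbourWithin (suc e) v c₁ c₂
  step-closer {v = v} v~v′ (w , w~c₁ , w~c₂ , w→v′) =
    w , w~c₁ , w~c₂ , ℕP.≤-trans (D-Adj-triangleʳ w (Adj-sym v~v′)) (s≤s w→v′)

  -- Step from v towards c₁ and towards c₂.  If neither step stays equidistant
  -- from c₁ and c₂, then c₁ c₂ v₂ v₁ is a short quadrilateral.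
  common-neighbour : ∀ e v {c₁ c₂} → Adj G c₁ c₂ → D v c₁ ≡ suc e → D v c₂ ≡ suc e → CommonNeighbourWithin e v c₁ c₂
  common-neighbour zero v _ v→c₁ v→c₂ = v , D≡1⇒Adj v→c₁ , D≡1⇒Adj v→c₂ , ℕP.≤-reflexive (D-refl v)
  common-neighbour (suc e) v {c₁} {c₂} c₁~c₂ v→c₁ v→c₂
    with v₁ , v~v₁ , v₁→c₁ ← geodesic-step v→c₁ | v₂ , v~v₂ , v₂→c₂ ← geodesic-step v→c₂
    with D v₁ c₂ ℕP.≟ suc e | D v₂ c₁ ℕP.≟ suc e
  ... | yes v₁→c₂ | _         = step-closer v~v₁ (common-neighbour e v₁ c₁~c₂ v₁→c₁ v₁→c₂)
  ... | no  _     | yes v₂→c₁ = step-closer v~v₂ (swap (common-neighbour e v₂ (Adj-sym c₁~c₂) v₂→c₂ v₂→c₁))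
    where
    swap : CommonNeighbourWithin e v₂ c₂ c₁ → CommonNeighbourWithin e v₂ c₁ c₂
    swap (w , w~c₂ , w~c₁ , w→v₂) = w , w~c₁ , w~c₂ , w→v₂
  ... | no  v₁↛c₂ | no  v₂↛c₁ =
    ⊥-elim (no-short-quadrilateral (Adj⇒≢ c₁~c₂) (D≡suc⇒≢ v₂→c₁ ∘ sym) (D≡suc⇒≢ v₁→c₁ ∘ sym)
                                   (D≡suc⇒≢ v₂→c₂ ∘ sym) (D≡suc⇒≢ v₁→c₂ ∘ sym) v₂≢v₁ short)
    where
    s = suc e
    v₁→c₂ : D v₁ c₂ ≡ suc s
    v₁→c₂ = squeeze (D-neighbour≥ v~v₁ v→c₂)
                    (subst (λ t → D v₁ c₂ ≤ suc t) v₁→c₁ (D-Adj-triangleʳ v₁ c₁~c₂)) v₁↛c₂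
    v₂→c₁ : D v₂ c₁ ≡ suc s
    v₂→c₁ = squeeze (D-neighbour≥ v~v₂ v→c₁)
                    (subst (λ t → D v₂ c₁ ≤ suc t) v₂→c₂ (D-Adj-triangleʳ v₂ (Adj-sym c₁~c₂))) v₂↛c₁
    v₂≢v₁ : v₂ ≢ v₁
    v₂≢v₁ refl = ℕP.<-irrefl (trans (sym v₁→c₁) v₂→c₁) (ℕP.n<1+n s)
    v₂→v₁ : D v₂ v₁ ≤ 2
    v₂→v₁ = ℕP.≤-trans (D-Adj-triangleˡ v₁ (Adj-sym v~v₂)) (s≤s (ℕP.≤-reflexive (Adj⇒D≡1 v~v₁)))
    short : D c₁ c₂ ℕ.+ D c₂ v₂ ℕ.+ D v₂ v₁ ℕ.+ D v₁ c₁ ≤ D c₁ v₂ ℕ.+ D c₂ v₁ ℕ.+ 1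
    short = begin
      D c₁ c₂ ℕ.+ D c₂ v₂ ℕ.+ D v₂ v₁ ℕ.+ D v₁ c₁
        ≤⟨ ℕP.+-monoˡ-≤ (D v₁ c₁) (ℕP.+-monoʳ-≤ (D c₁ c₂ ℕ.+ D c₂ v₂) v₂→v₁) ⟩
      D c₁ c₂ ℕ.+ D c₂ v₂ ℕ.+ 2 ℕ.+ D v₁ c₁
        ≡⟨ cong₂ (λ a b → a ℕ.+ b ℕ.+ 2 ℕ.+ D v₁ c₁) (Adj⇒D≡1 c₁~c₂) (trans (D-sym c₂ v₂) v₂→c₂) ⟩
      1 ℕ.+ s ℕ.+ 2 ℕ.+ D v₁ c₁
        ≡⟨ cong (1 ℕ.+ s ℕ.+ 2 ℕ.+_) v₁→c₁ ⟩
      1 ℕ.+ s ℕ.+ 2 ℕ.+ s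
        ≡⟨ rearrange s ⟩
      suc s ℕ.+ suc s ℕ.+ 1
        ≡⟨ cong₂ (λ a b → a ℕ.+ b ℕ.+ 1) (trans (D-sym c₁ v₂) v₂→c₁) (trans (D-sym c₂ v₁) v₁→c₂) ⟨
      D c₁ v₂ ℕ.+ D c₂ v₁ ℕ.+ 1
        ∎
      where
      open ℕP.≤-Reasoning
      rearrange : ∀ t → 1 ℕ.+ t ℕ.+ 2 ℕ.+ t ≡ suc t ℕ.+ suc t ℕ.+ 1
      rearrange = ℕ-Solver.solve-∀

  nearest-point-unique : ∀ {v K c₁ c₂ δ} → IsMaximalClique G K → c₁ ∈ K → c₂ ∈ K → c₁ ≢ c₂ →
                         D v c₁ ≡ δ → D v c₂ ≡ δ → (∀ c → c ∈ K → δ ≤ D v c) → ⊥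
  nearest-point-unique {δ = zero} _ _ _ c₁≢c₂ v→c₁ v→c₂ _ = c₁≢c₂ (trans (sym (D≡0⇒≡ v→c₁)) (D≡0⇒≡ v→c₂))
  nearest-point-unique {v} {K} {c₁} {c₂} {suc e} K-max c₁∈K c₂∈K c₁≢c₂ v→c₁ v→c₂ δ-min
    with c₁~c₂ ← proj₁ K-max c₁ c₂ c₁∈K c₂∈K c₁≢c₂
    with w , w~c₁ , w~c₂ , w→v ← common-neighbour e v c₁~c₂ v→c₁ v→c₂
    with w SubsetP.∈? K
  ... | yes w∈K = ℕP.<-irrefl refl (ℕP.<-≤-trans (s≤s w→v) (subst (suc e ≤_) (D-sym v w) (δ-min w w∈K)))
  ... | no  w∉K with c₃ , c₃∈K , ¬w~c₃ ← maximal-excludes K-max w∉K =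
    no-short-quadrilateral (Adj⇒≢ w~c₁) w≢c₃ (Adj⇒≢ w~c₂) c₁≢c₃ c₁≢c₂ c₃≢c₂ short
    where
    w≢c₃ : w ≢ c₃
    w≢c₃ w≡c₃ = w∉K (subst (_∈ K) (sym w≡c₃) c₃∈K)
    c₁≢c₃ : c₁ ≢ c₃
    c₁≢c₃ c₁≡c₃ = ¬w~c₃ (subst (Adj G w) c₁≡c₃ w~c₁)
    c₃≢c₂ : c₃ ≢ c₂
    c₃≢c₂ c₃≡c₂ = ¬w~c₃ (subst (Adj G w) (sym c₃≡c₂) w~c₂)
    short : D w c₁ ℕ.+ D c₁ c₃ ℕ.+ D c₃ c₂ ℕ.+ D c₂ w ≤ D w c₃ ℕ.+ D c₁ c₂ ℕ.+ 1
    short = begin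
      D w c₁ ℕ.+ D c₁ c₃ ℕ.+ D c₃ c₂ ℕ.+ D c₂ w  ≡⟨ cong₂ ℕ._+_ (cong₂ ℕ._+_ (cong₂ ℕ._+_ (Adj⇒D≡1 w~c₁)
                                                     (Adj⇒D≡1 (proj₁ K-max c₁ c₃ c₁∈K c₃∈K c₁≢c₃)))
                                                     (Adj⇒D≡1 (proj₁ K-max c₃ c₂ c₃∈K c₂∈K c₃≢c₂)))
                                                     (Adj⇒D≡1 (Adj-sym w~c₂)) ⟩
      2 ℕ.+ 2                                   ≤⟨ ℕP.+-monoˡ-≤ 2 (≢∧¬Adj⇒2≤D w≢c₃ ¬w~c₃) ⟩
      D w c₃ ℕ.+ 2                              ≡⟨ ℕP.+-assoc (D w c₃) 1 1 ⟨
      D w c₃ ℕ.+ 1 ℕ.+ 1                        ≡⟨ cong (λ t → D w c₃ ℕ.+ t ℕ.+ 1) (Adj⇒D≡1 c₁~c₂) ⟨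
      D w c₃ ℕ.+ D c₁ c₂ ℕ.+ 1                  ∎
      where open ℕP.≤-Reasoning

  other-points-farther : ∀ {v K c c′} → IsMaximalClique G K → c ∈ K → c′ ∈ K → c′ ≢ c →
                         (∀ k → k ∈ K → D v c ≤ D v k) → D v c′ ≡ suc (D v c)
  other-points-farther {v} {K} {c} {c′} K-max c∈K c′∈K c′≢c c-nearest =
    squeeze (c-nearest c′ c′∈K) (D-Adj-triangleʳ v (proj₁ K-max c c′ c∈K c′∈K (c′≢c ∘ sym)))
            (λ v→c′ → nearest-point-unique K-max c∈K c′∈K (c′≢c ∘ sym) refl v→c′ c-nearest)

  closest-pairs-share-endpoint : ∀ {C C′ x y b c m} → IsMaximalClique G C → IsMaximalClique G C′ →
    x ∈ C → y ∈ C′ → b ∈ C′ → c ∈ C → b ≢ y → D x y ≡ suc m → D x b ≡ suc (suc m) → D c b ≡ suc m →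
    (∀ k → k ∈ C′ → suc m ≤ D c k) → ⊥
  closest-pairs-share-endpoint {C} {C′} {x} {y} {b} {c} {m} C-max C′-max x∈C y∈C′ b∈C′ c∈C b≢y x→y x→b c→b c-far =
    no-short-quadrilateral (D≡suc⇒≢ x→y) (D≡suc⇒≢ x→b) (c≢x ∘ sym) (b≢y ∘ sym)
                           (D≡suc⇒≢ c→y ∘ sym) (D≡suc⇒≢ c→b ∘ sym) short
    where
    c≢x : c ≢ x
    c≢x refl = ℕP.<-irrefl (trans (sym c→b) x→b) (ℕP.n<1+n (suc m))
    c→y : D c y ≡ suc (suc m)
    c→y = trans (other-points-farther C′-max b∈C′ y∈C′ (b≢y ∘ sym)
                   (λ k k∈C′ → subst (_≤ D c k) (sym c→b) (c-far k k∈C′)))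
                (cong suc c→b)
    short : D x y ℕ.+ D y b ℕ.+ D b c ℕ.+ D c x ≤ D x b ℕ.+ D y c ℕ.+ 1
    short = begin
      D x y ℕ.+ D y b ℕ.+ D b c ℕ.+ D c x  ≡⟨ cong₂ ℕ._+_ (cong₂ ℕ._+_ (cong₂ ℕ._+_ x→y
                                                (Adj⇒D≡1 (proj₁ C′-max y b y∈C′ b∈C′ (b≢y ∘ sym))))
                                                (trans (D-sym b c) c→b))
                                                (Adj⇒D≡1 (proj₁ C-max c x c∈C x∈C c≢x)) ⟩
      suc m ℕ.+ 1 ℕ.+ suc m ℕ.+ 1           ≡⟨ rearrange (suc m) ⟩
      suc (suc m) ℕ.+ suc (suc m)           ≤⟨ ℕP.m≤m+n _ 1 ⟩
      suc (suc m) ℕ.+ suc (suc m) ℕ.+ 1     ≡⟨ cong₂ (λ s t → s ℕ.+ t ℕ.+ 1) x→b (trans (D-sym y c) c→y) ⟨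
      D x b ℕ.+ D y c ℕ.+ 1                 ∎
      where
      open ℕP.≤-Reasoning
      rearrange : ∀ t → t ℕ.+ 1 ℕ.+ t ℕ.+ 1 ≡ suc t ℕ.+ suc t
      rearrange = ℕ-Solver.solve-∀

  -- Let c ∈ C be nearest to b.  D c b = D x y is excluded, so D c b = D x b and
  -- x is nearest to b in C; the other point a is then one step farther.
  far-from-second-points : ∀ {C C′ x y a b m} → IsMaximalClique G C → IsMaximalClique G C′ →
    x ∈ C → y ∈ C′ → a ∈ C → b ∈ C′ → a ≢ x → b ≢ y → D x y ≡ suc m →
    (∀ x′ y′ → x′ ∈ C → y′ ∈ C′ → suc m ≤ D x′ y′) → suc (suc (suc m)) ≤ D a b
  far-from-second-points {C} {C′} {x} {y} {a} {b} {m} C-max C′-max x∈C y∈C′ a∈C b∈C′ a≢x b≢y x→y nearest =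
    from-nearest-to-b (argmin FinP.any? (SubsetP._∈? C) (λ c → D c b) (x , x∈C))
    where
    x→b : D x b ≡ suc (suc m)
    x→b = trans (other-points-farther C′-max y∈C′ b∈C′ b≢y
                   (λ k k∈C′ → subst (_≤ D x k) (sym x→y) (nearest x k x∈C k∈C′)))
                (cong suc x→y)
    from-nearest-to-b : (∃ λ c → c ∈ C × (∀ k → k ∈ C → D c b ≤ D k b)) → suc (suc (suc m)) ≤ D a b
    from-nearest-to-b (c , c∈C , c-nearest) with D c b ℕP.≟ suc m
    ... | yes c→b = ⊥-elim (closest-pairs-share-endpoint C-max C′-max x∈C y∈C′ b∈C′ c∈C b≢y x→y x→b c→b
                                                        (λ k k∈C′ → nearest c k c∈C k∈C′))
    ... | no  c↛b = ℕP.≤-reflexive (sym (trans (D-sym a b) b→a))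
      where
      c→b : D c b ≡ suc (suc m)
      c→b = squeeze (nearest c b c∈C b∈C′) (subst (D c b ≤_) x→b (c-nearest x x∈C)) c↛b
      b→a : D b a ≡ suc (suc (suc m))
      b→a = trans (other-points-farther C-max x∈C a∈C a≢x
                     (λ k k∈C → subst₂ _≤_ (trans c→b (sym (trans (D-sym b x) x→b))) (D-sym k b) (c-nearest k k∈C)))
                  (cong suc (trans (D-sym b x) x→b))

  far-apart : ∀ {C C′ x y} → IsMaximalClique G C → IsMaximalClique G C′ → C ≢ C′ → x ∈ C → y ∈ C′ →
              (∀ x′ y′ → x′ ∈ C → y′ ∈ C′ → D x y ≤ D x′ y′) → ∃ λ a → ∃ λ b → suc (suc (D x y)) ≤ D a b
  far-apart {C} {C′} {x} {y} C-max C′-max C≢C′ x∈C y∈C′ xy-nearest with D x y in x→y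
  ... | zero
    with a , a∈C , a∉C′ ← maximal-⊈ C-max (proj₁ C′-max) C≢C′
    with b , b∈C′ , ¬a~b ← maximal-excludes C′-max a∉C′ =
    a , b , ≢∧¬Adj⇒2≤D (λ a≡b → a∉C′ (subst (_∈ C′) (sym a≡b) b∈C′)) ¬a~b
  ... | suc m
    with x′ , x~x′ , _ ← geodesic-step x→y
    with y′ , y~y′ , _ ← geodesic-step (trans (D-sym y x) x→y)
    with a , a∈C , a≢x ← maximal-has-second C-max x∈C x~x′
    with b , b∈C′ , b≢y ← maximal-has-second C′-max y∈C′ y~y′ =
    a , b , far-from-second-points C-max C′-max x∈C y∈C′ a∈C b∈C′ a≢x b≢y x→y xy-nearest

module CliqueWalks {n} {G : SimpleGraph n} {D : Fin n → Fin n → ℕ} (D-dist : IsDistMatrix G D) where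
  open Graph G
  open Distance D-dist
  open Cliques G

  clique-D≤1 : ∀ {K u z} → IsClique G K → u ∈ K → z ∈ K → D u z ≤ 1
  clique-D≤1 {u = u} {z} K-clique u∈K z∈K with u ≟ z
  ... | yes refl = ℕP.≤-trans (ℕP.≤-reflexive (D-refl u)) z≤n
  ... | no  u≢z  = ℕP.≤-reflexive (Adj⇒D≡1 (K-clique u z u∈K z∈K u≢z))

  clique-walk : ∀ {C′ y} → IsMaximalClique G C′ → y ∈ C′ → ∀ {L u K} → Walk G u y L →
                IsMaximalClique G K → u ∈ K → K ≢ C′ → (∀ z y′ → z ∈ K → y′ ∈ C′ → L ≤ D z y′) →
                CliqueWalk G K C′ (suc L)
  clique-walk C′-max y∈C′ {u = u} nil K-max u∈K K≢C′ _ = cons C′-max K≢C′ (u , SubsetP.x∈p∩q⁺ (u∈K , y∈C′)) nil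
  clique-walk {C′} {y} C′-max y∈C′ {suc L} {u} {K} (cons {y = u′} u~u′ w) K-max u∈K K≢C′ far
    with K′ , K′-max , uu′⊆K′ ← extend-to-maximal (edge-clique u~u′) =
    cons K′-max K≢K′ (u , SubsetP.x∈p∩q⁺ (u∈K , u∈K′)) (clique-walk C′-max y∈C′ w K′-max u′∈K′ K′≢C′ far′)
    where
    u∈K′ : u ∈ K′
    u∈K′ = uu′⊆K′ (SubsetP.x∈p∪q⁺ (inj₁ (SubsetP.x∈⁅x⁆ u)))
    u′∈K′ : u′ ∈ K′
    u′∈K′ = uu′⊆K′ (SubsetP.x∈p∪q⁺ (inj₂ (SubsetP.x∈⁅x⁆ u′)))
    K≢K′ : K ≢ K′
    K≢K′ refl = ℕP.<-irrefl refl (ℕP.<-≤-trans (s≤s (D-minimal w)) (far u′ y u′∈K′ y∈C′))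
    K′≢C′ : K′ ≢ C′
    K′≢C′ refl = ℕP.n≮0 (subst (suc L ≤_) (D-refl u) (far u u u∈K u∈K′))
    far′ : ∀ z y′ → z ∈ K′ → y′ ∈ C′ → L ≤ D z y′
    far′ z y′ z∈K′ y′∈C′ = ℕP.≤-pred (begin
      suc L                 ≤⟨ far u y′ u∈K y′∈C′ ⟩
      D u y′                ≤⟨ D-triangle u z y′ ⟩
      D u z ℕ.+ D z y′      ≤⟨ ℕP.+-monoˡ-≤ (D z y′) (clique-D≤1 (proj₁ K′-max) u∈K′ z∈K′) ⟩
      suc (D z y′)          ∎)
      where open ℕP.≤-Reasoning

any?-pair : ∀ {n} {P : Fin n × Fin n → Set} → Decidable P → Dec (∃ P)
any?-pair P? = map′ (λ (x , y , p) → (x , y) , p) (λ ((x , y) , p) → x , y , p)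
                        (FinP.any? (λ x → FinP.any? (λ y → P? (x , y))))

module _ {n} {G : SimpleGraph n} {D : Fin n → Fin n → ℕ} (D-dist : IsDistMatrix G D)
         (q : ℚ) (D≤q : QEC≤ D q) (q<-½ : twice q + 1ℚ ℚ.< 0ℚ) where
  open Distance D-dist
  open Cliques G
  open CliqueWalks D-dist
  open CliqueGeometry D-dist q D≤q q<-½

  closest-pair : Fin n → ∀ {C C′} → IsMaximalClique G C → IsMaximalClique G C′ →
                 ∃ λ x → ∃ λ y → x ∈ C × y ∈ C′ × (∀ x′ y′ → x′ ∈ C → y′ ∈ C′ → D x y ≤ D x′ y′)
  closest-pair v {C} {C′} C-max C′-max
    with c , c∈C ← maximal-nonempty C-max v | c′ , c′∈C′ ← maximal-nonempty C′-max v
    with (x , y) , (x∈C , y∈C′) , nearest ← argmin any?-pair (λ (x , y) → (x SubsetP.∈? C) ×-dec (y SubsetP.∈? C′))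
                                                (λ (x , y) → D x y) ((c , c′) , (c∈C , c′∈C′)) =
    x , y , x∈C , y∈C′ , λ x′ y′ x′∈C y′∈C′ → nearest (x′ , y′) (x′∈C , y′∈C′)

  clique-diam≤diam∸1 : Fin n → ∀ k → DiamLe D (suc k) → CliqueDiamLe G k
  clique-diam≤diam∸1 v k diam≤ C C′ C-max C′-max with VecP.≡-dec Bool._≟_ C C′
  ... | yes refl = 0 , z≤n , nil
  ... | no  C≢C′ with x , y , x∈C , y∈C′ , closest ← closest-pair v C-max C′-max with suc (D x y) ℕP.≤? k
  ... | yes 1+D≤k = suc (D x y) , 1+D≤k , clique-walk C′-max y∈C′ (geodesic x y) C-max x∈C C≢C′ closest
  ... | no  1+D≰k with a , b , far ← far-apart C-max C′-max C≢C′ x∈C y∈C′ closest =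
    ⊥-elim (1+D≰k (ℕP.≤-pred (ℕP.≤-trans far (diam≤ a b))))

proposition6p1 : (d : ℕ) → 3 ≤ d → (n : ℕ) → 2 ≤ n → (G : SimpleGraph n) →
    Connected G → (D : Fin n → Fin n → ℕ) → IsDistMatrix G D →
    (DP : Fin d → Fin d → ℕ) → IsDistMatrix (Path d) DP →
    QEC< D DP →
    DiamLe D (d ∸ 2) × CliqueDiamLe G (d ∸ 3)
-- Connectedness is implied by IsDistMatrix G D.  Matching on 3 ≤ d makes
-- d ∸ 2 reduce to suc (d ∸ 3).
proposition6p1 d (s≤s (s≤s (s≤s _))) n (s≤s (s≤s _)) G _ D D-dist DP DP-dist D<DP@(q , D≤q , DP>q) =
  diam≤ , clique-diam≤diam∸1 D-dist q D≤q (QEC>-Path⇒<-½ DP-dist q DP>q) 0F (d ∸ 3) diam≤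
  where
  diam≤ : DiamLe D (d ∸ 2)
  diam≤ = QEC<Path⇒diam≤ D-dist DP-dist D<DP
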